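{- There is no reverse divisor with exactly $3$ decimal digits.
   Context: Reverse divisor: a non-palindromic positive integer $x$ with $n\ge 2$ decimal digits is a reverse divisor if its reverse $x'$ (the integer whose decimal digits are those of $x$ in reverse order) satisfies $x'=k\cdot x$ for some integer $k$ with $1<k<10$. -}

module Defs where

open import Data.Nat using (ℕ; zero; suc; _+_; _*_; _<_)
open import Data.Nat.DivMod using (_/_; _%_)
open import Data.List using (List; []; _∷_; length; reverse; foldr)
open import Data.Product using (∃-syntax; _×_)
open import Relation.Binary.PropositionalEquality using (_≡_)
open import Relation.Nullary using (¬_)

-- Little-endian decimal digits of n, computed with a fuel argument
-- (fuel = n suffices since n / 10 < n for n > 0).
digitsAux : ℕ → ℕ → List ℕ
digitsAux zero    _       = []
digitsAux (suc f) zero    = []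
digitsAux (suc f) (suc n) = (suc n % 10) ∷ digitsAux f (suc n / 10)

-- decimal digits of x, least significant first (no leading zeros; digits 0 = [])
digits : ℕ → List ℕ
digits x = digitsAux x x

fromDigits : List ℕ → ℕ
fromDigits = foldr (λ d acc → d + 10 * acc) 0

rev : ℕ → ℕ
rev x = fromDigits (reverse (digits x))

numDigits : ℕ → ℕ
numDigits x = length (digits x)

Palindrome : ℕ → Set
Palindrome x = digits x ≡ reverse (digits x)

ReverseDivisor : ℕ → Set
ReverseDivisor x =
  0 < x × 2 Data.Nat.≤ numDigits x × ¬ Palindrome x ×
  ∃[ k ] (1 < k × k < 10 × rev x ≡ k * x)

-- A number with three digits is below 1000, and no positive x < 1000 satisfies
-- rev x = k x with 1 < k < 10: the finitely many cases are refuted by evaluation.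
module Submission where

open import Defs
open import Data.Nat using (ℕ; zero; suc; _+_; _*_; _^_; _<_; _≤_; z≤n; s≤s; _≟_; _<?_)
open import Data.Nat.DivMod using (_/_; _%_; m/n<m; m%n<n; m≡m%n+[m/n]*n)
open import Data.Nat.Properties using (≤-refl; ≤-trans; ≤-pred; *-comm; *-monoˡ-≤; +-monoˡ-<; allUpTo?; module ≤-Reasoning)
open import Data.List using (length)
open import Data.Product using (_,_)
open import Relation.Binary.PropositionalEquality using (_≡_; _≢_; subst)
open import Relation.Nullary using (¬_)
open import Relation.Nullary.Decidable using (Dec; ¬?; _→-dec_; toWitness)

<10^length-digitsAux : ∀ f n → n ≤ f → n < 10 ^ length (digitsAux f n)
<10^length-digitsAux zero    zero    _         = s≤s z≤n
<10^length-digitsAux (suc f) zero    _         = s≤s z≤n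
<10^length-digitsAux (suc f) (suc n) (s≤s n≤f) = begin-strict
  suc n                 ≡⟨ m≡m%n+[m/n]*n (suc n) 10 ⟩
  suc n % 10 + q * 10   <⟨ +-monoˡ-< (q * 10) (m%n<n (suc n) 10) ⟩
  suc q * 10            ≤⟨ *-monoˡ-≤ 10 q<10^L ⟩
  10 ^ L * 10           ≡⟨ *-comm (10 ^ L) 10 ⟩
  10 ^ suc L            ∎
  where
  open ≤-Reasoning
  q : ℕ
  q = suc n / 10
  L : ℕ
  L = length (digitsAux f q)
  q<10^L : q < 10 ^ L
  q<10^L = <10^length-digitsAux f q (≤-trans (≤-pred (m/n<m (suc n) 10 (s≤s (s≤s z≤n)))) n≤f)

<10^numDigits : ∀ n → n < 10 ^ numDigits n
<10^numDigits n = <10^length-digitsAux n n ≤-refl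

NoReverseMultiple : ℕ → Set
NoReverseMultiple x = ∀ {k} → k < 10 → 1 < k → rev x ≢ k * x

noReverseMultiple? : ∀ x → Dec (NoReverseMultiple x)
noReverseMultiple? x = allUpTo? (λ k → 1 <? k →-dec ¬? (rev x ≟ k * x)) 10

noReverseMultipleBelow1000 : ∀ {x} → x < 1000 → 0 < x → NoReverseMultiple x
noReverseMultipleBelow1000 = toWitness {a? = allUpTo? (λ x → 0 <? x →-dec noReverseMultiple? x) 1000} _

proposition15 : (x : ℕ) → numDigits x ≡ 3 → ¬ ReverseDivisor x
proposition15 x three (0<x , _ , _ , k , 1<k , k<10 , rev≡kx) =
  noReverseMultipleBelow1000 x<1000 0<x k<10 1<k rev≡kx
  where
  x<1000 : x < 1000
  x<1000 = subst (λ d → x < 10 ^ d) three (<10^numDigits x)
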